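{- Let $s,n\ge 3$. Suppose that in the vertex online Ramsey game for $(K_{1,s-1}^*,K_{n-1})$, Builder has a strategy which ensures a red $K_{1,s-1}^*$ or a blue $K_{n-1}$ using at most $v$ vertices, at most $r$ red edges, and at most $m$ edges in total. Then for any $0<\alpha\le\frac12$, \[ r(L_{K_s},K_n^{(3)})\le (v+1)\alpha^{ -r}(1-\alpha)^{r-m}. \]
   Context: Vertex online Ramsey game for ordered graphs $H_1,H_2$: Builder and Painter start from the empty graph; at step $i$ a new vertex $v_i$ is revealed, and for each existing vertex $v_j$ ($j=1,\dots,i-1$), in order, Builder decides whether to draw the edge $\{v_j,v_i\}$; if drawn, Painter immediately colors it red or blue. Builder wins when the current graph contains a red ordered copy of $H_1$ or a blue ordered copy of $H_2$ (vertices ordered by arrival). The forward star $K_{1,s-1}^*$ is the ordered graph on $s$ vertices whose first vertex is adjacent to each of the other $s-1$ vertices (and no other edges); $K_{n-1}$ is the complete graph. $r(H_1,H_2)$ for $3$-graphs is the smallest $N$ such that every $3$-graph on $N$ vertices contains $H_1$ or its complement contains $H_2$. $K_n^{(3)}$ is the complete $3$-graph on $n$ vertices; $L_{K_s}$ is the $3$-graph on $V(K_s)\cup\{u\}$ whose edges are all triples $\{u,x,y\}$ with $x,y\in V(K_s)$ distinct.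
   Formalization: The parameter α ranges over the rationals with $0<\alpha\le\frac12$. -}

module Defs where

open import Data.Nat using (ℕ; zero; suc; _+_; _≤_; _<_; pred)
open import Data.Nat.Properties using (_<?_)
open import Data.Fin using (Fin; toℕ) renaming (zero to fzero; suc to fsuc)
open import Data.Fin.Properties using () renaming (_≟_ to _≟F_)
open import Data.Bool using (Bool; true; false; not; _∨_; if_then_else_)
open import Data.Bool.Properties using (∨-comm; ∨-assoc)
open import Data.List using (List; []; _∷_; _++_; length; lookup)
open import Data.Product using (Σ; ∃; ∃-syntax; _×_; _,_; proj₁; proj₂)
open import Data.Sum using (_⊎_)
open import Function.Definitions using (Injective)
open import Relation.Binary.PropositionalEquality using (_≡_; refl; cong; trans; sym)
open import Relation.Nullary using (¬_; yes; no)
open import Data.Integer using (+_)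
import Data.Rational as ℚ
open ℚ using (ℚ; 1ℚ; _/_)

-- Only triples of pairwise distinct vertices are meaningful; the value
-- on triples with a repeated vertex is never consulted.
record 3Graph (V : Set) : Set where
  field
    edge : V → V → V → Bool
    sym₁ : ∀ x y z → edge x y z ≡ edge y x z
    sym₂ : ∀ x y z → edge x y z ≡ edge x z y
open 3Graph public

Distinct3 : {V : Set} → V → V → V → Set
Distinct3 x y z = ¬ x ≡ y × ¬ x ≡ z × ¬ y ≡ z

complement : {V : Set} → 3Graph V → 3Graph V
complement G = record
  { edge = λ x y z → not (edge G x y z)
  ; sym₁ = λ x y z → cong not (sym₁ G x y z)
  ; sym₂ = λ x y z → cong not (sym₂ G x y z) }

Contains : {U V : Set} → 3Graph U → 3Graph V → Set
Contains {U} {V} H G =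
  Σ (U → V) λ f → Injective _≡_ _≡_ f ×
    (∀ x y z → Distinct3 x y z → edge H x y z ≡ true →
       edge G (f x) (f y) (f z) ≡ true)

K3 : (n : ℕ) → 3Graph (Fin n)
K3 n = record { edge = λ _ _ _ → true ; sym₁ = λ _ _ _ → refl ; sym₂ = λ _ _ _ → refl }

isZero : {k : ℕ} → Fin k → Bool
isZero fzero = true
isZero (fsuc _) = false

-- L_{K_s}: vertex set Fin (suc s), the vertex u is fzero, V(K_s) = fsuc _;
-- a triple of distinct vertices is an edge iff it contains u.
LK : (s : ℕ) → 3Graph (Fin (suc s))
LK s = record
  { edge = λ x y z → isZero x ∨ isZero y ∨ isZero z
  ; sym₁ = λ x y z → trans (sym (∨-assoc (isZero x) (isZero y) (isZero z)))
             (trans (cong (_∨ isZero z) (∨-comm (isZero x) (isZero y)))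
                    (∨-assoc (isZero y) (isZero x) (isZero z)))
  ; sym₂ = λ x y z → cong (isZero x ∨_) (∨-comm (isZero y) (isZero z)) }

-- Ramsey property: every 3-graph on N vertices contains H₁ or its
-- complement contains H₂.  r(H₁,H₂) is the least N with this property.
RamseyProp : {U W : Set} → 3Graph U → 3Graph W → ℕ → Set
RamseyProp H₁ H₂ N = (G : 3Graph (Fin N)) → Contains H₁ G ⊎ Contains H₂ (complement G)

-- An ordered graph on t vertices 0 < 1 < ... < t-1; adj a b is only
-- consulted for toℕ a < toℕ b.
record OGraph (t : ℕ) : Set where
  field adj : Fin t → Fin t → Bool
open OGraph public

ForwardStar : (s : ℕ) → OGraph s
ForwardStar s = record { adj = λ a _ → isZero a }

Kcomplete : (t : ℕ) → OGraph t
Kcomplete t = record { adj = λ _ _ → true }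

data Colour : Set where
  red blue : Colour

data Move : Set where
  skip    : Move
  painted : Colour → Move

-- Vertices are v₀, v₁, v₂, ... (0-based).  Decision points are the pairs
-- (j , i) with j < i, in the order (0,1),(0,2),(1,2),(0,3),(1,3),(2,3),...
-- i.e. at step i the new vertex vᵢ is revealed and Builder considers
-- v₀,…,v_{i-1} in order.
nextPair : ℕ × ℕ → ℕ × ℕ
nextPair (j , i) with suc j <? i
... | yes _ = (suc j , i)
... | no  _ = (0 , suc i)

pairAt : ℕ → ℕ × ℕ
pairAt zero    = (0 , 1)
pairAt (suc k) = nextPair (pairAt k)

-- A history lists the moves made so far, in chronological order;
-- the k-th entry concerns the pair pairAt k.
History : Set
History = List Move

BuilderStrategy : Set
BuilderStrategy = History → Bool

PainterStrategy : Set
PainterStrategy = History → Colour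

play : BuilderStrategy → PainterStrategy → ℕ → History
play B P zero    = []
play B P (suc k) = let h = play B P k in
  h ++ ((if B h then painted (P h) else skip) ∷ [])

HasEdge : History → Colour → ℕ → ℕ → Set
HasEdge h c j i = ∃[ k ] (pairAt (toℕ k) ≡ (j , i)) × (lookup h k ≡ painted c)

HasOrderedCopy : {t : ℕ} → History → Colour → OGraph t → Set
HasOrderedCopy {t} h c H =
  Σ (Fin t → ℕ) λ f →
    (∀ a b → toℕ a < toℕ b → f a < f b) ×
    (∀ a b → toℕ a < toℕ b → adj H a b ≡ true → HasEdge h c (f a) (f b))

-- number of vertices revealed so far (i+1 if the last decision concerned
-- a pair (j , i))
vertexCount : History → ℕ
vertexCount []      = 0
vertexCount (x ∷ h) = suc (proj₂ (pairAt (length h)))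

redCount : History → ℕ
redCount []                 = 0
redCount (painted red ∷ h)  = suc (redCount h)
redCount (painted blue ∷ h) = redCount h
redCount (skip ∷ h)         = redCount h

edgeCount : History → ℕ
edgeCount []            = 0
edgeCount (painted _ ∷ h) = suc (edgeCount h)
edgeCount (skip ∷ h)    = edgeCount h

BuilderWinsWithin : {t₁ t₂ : ℕ} → OGraph t₁ → OGraph t₂ →
                    BuilderStrategy → ℕ → ℕ → ℕ → Set
BuilderWinsWithin H₁ H₂ B v r m =
  (P : PainterStrategy) → ∃[ L ]
    let h = play B P L in
    (HasOrderedCopy h red H₁ ⊎ HasOrderedCopy h blue H₂) ×
    vertexCount h ≤ v × redCount h ≤ r × edgeCount h ≤ m

_^ℚ_ : ℚ → ℕ → ℚ
q ^ℚ zero  = 1ℚ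
q ^ℚ suc k = q ℚ.* (q ^ℚ k)

ℕtoℚ : ℕ → ℚ
ℕtoℚ n = (+ n) / 1

module Submission where

-- Painter answers Builder inside an arbitrary 3-graph G on N vertices: game vertices are embedded
-- into G one by one, each new vertex taken from a reservoir S of unused vertices. When Builder draws
-- {v_j , v_i}, Painter keeps in S only those x for which {φ v_j , φ v_i , x} is an edge of G (red) or
-- a non-edge (blue), preferring red whenever this keeps at least an α-fraction of S. Every coloured
-- edge thus sees, with its colour, all vertices embedded later and all of S, while
-- |S| + #revealed ≥ α^(red) (1 - α)^(blue) N throughout. If (N + 1) α^r (1 - α)^(m - r) > v + 1, the
-- reservoir is still non-empty when Builder wins, and a remaining vertex w completes a red forward
-- star (centre u) to L_{K_s} in G, or a blue K_{n-1} to K_n in its complement. Taking N maximal with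
-- N α^r (1 - α)^m ≤ (v + 1) (1 - α)^r gives the bound.

open import Defs
open import Data.Bool using (Bool; true; false; not; if_then_else_; T?)
open import Data.Bool.Properties using (T-≡)
open import Data.Empty using (⊥-elim)
open import Data.Fin using (Fin; toℕ) renaming (zero to fzero; suc to fsuc)
import Data.Fin.Properties as Fin
open import Data.List using (List; []; _∷_; _∷ʳ_; length; lookup; filterᵇ; tabulate)
open import Data.List.Properties using (length-++; length-tabulate)
open import Data.List.Membership.Propositional using (_∈_)
open import Data.List.Membership.Propositional.Properties using (∈-filter⁻; ∈-tabulate⁻)
open import Data.List.Relation.Unary.Any using (here; there)
import Data.List.Relation.Unary.All as All
open import Data.List.Relation.Unary.Unique.Propositional using (Unique; []; _∷_)
import Data.List.Relation.Unary.Unique.Propositional.Properties as Unique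
open import Data.Product using (Σ; ∃; ∃-syntax; _×_; _,_; proj₁; proj₂)
open import Data.Sum as Sum using (_⊎_; inj₁; inj₂; [_,_]′)
open import Function using (_∘_; Equivalence)
open import Function.Definitions using (Injective)
open import Relation.Nullary using (¬_; Dec; yes; no)
open import Relation.Binary.Definitions using (tri<; tri≈; tri>)
open import Relation.Binary.PropositionalEquality
import Data.Nat as ℕ
import Data.Nat.Properties as ℕ
import Data.Rational as ℚ
import Data.Rational.Properties as ℚ
import Data.Rational.Solver as Solver

module Arithmetic where

  open import Data.Nat using (ℕ; zero; suc)
  open import Data.Integer as ℤ using (+_)
  import Data.Integer.Properties as ℤ
  import Data.Nat.Coprimality as Coprimality
  open import Data.Rational
    using ( ℚ; mkℚ; _/_; 0ℚ; 1ℚ; _<_; _≤_; _*_; _+_; _-_; -_; *≤*; *<*; 1/_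
          ; positive; nonNegative; Positive; NonZero)
  open import Data.Rational.Properties
  open Solver.+-*-Solver using (solve; con; _:+_; _:-_; _:*_; _:=_)

  ℕtoℚ≡mkℚ : ∀ n → ℕtoℚ n ≡ mkℚ (+ n) 0 (Coprimality.sym (Coprimality.1-coprimeTo n))
  ℕtoℚ≡mkℚ n = normalize-coprime _

  ℕtoℚ-+ : ∀ a b → ℕtoℚ (a ℕ.+ b) ≡ ℕtoℚ a + ℕtoℚ b
  ℕtoℚ-+ a b rewrite ℕtoℚ≡mkℚ a | ℕtoℚ≡mkℚ b =
    cong (_/ 1) (sym (cong₂ ℤ._+_ (ℤ.*-identityʳ (+ a)) (ℤ.*-identityʳ (+ b))))

  ℕtoℚ-mono-≤ : ∀ {a b} → a ℕ.≤ b → ℕtoℚ a ≤ ℕtoℚ b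
  ℕtoℚ-mono-≤ {a} {b} a≤b rewrite ℕtoℚ≡mkℚ a | ℕtoℚ≡mkℚ b =
    *≤* (ℤ.*-monoʳ-≤-nonNeg (+ 1) (ℤ.+≤+ a≤b))

  ℕtoℚ-cancel-< : ∀ a b → ℕtoℚ a < ℕtoℚ b → a ℕ.< b
  ℕtoℚ-cancel-< a b a<b rewrite ℕtoℚ≡mkℚ a | ℕtoℚ≡mkℚ b with a<b
  ... | *<* a<b′ rewrite ℤ.*-identityʳ (+ a) | ℤ.*-identityʳ (+ b) = ℤ.drop‿+<+ a<b′

  ℕtoℚ-nonNeg : ∀ n → 0ℚ ≤ ℕtoℚ n
  ℕtoℚ-nonNeg n = ℕtoℚ-mono-≤ {0} {n} ℕ.z≤n

  <⇒≱ : ∀ {p q} → p < q → ¬ (q ≤ p)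
  <⇒≱ p<q q≤p = <-irrefl refl (<-≤-trans p<q q≤p)

  +-cancelˡ-< : ∀ a {p q} → a + p < a + q → p < q
  +-cancelˡ-< a {p} {q} a+p<a+q = subst₂ _<_ (-a+[a+x]≡x p) (-a+[a+x]≡x q) (+-monoʳ-< (- a) a+p<a+q)
    where
    -a+[a+x]≡x : ∀ x → - a + (a + x) ≡ x
    -a+[a+x]≡x x = trans (sym (+-assoc (- a) a x)) (trans (cong (_+ x) (+-inverseˡ a)) (+-identityˡ x))

  +-cancelʳ-≤ : ∀ a {p q} → p + a ≤ q + a → p ≤ q
  +-cancelʳ-≤ a {p} {q} p+a≤q+a = subst₂ _≤_ (x+a-a≡x p) (x+a-a≡x q) (+-monoˡ-≤ (- a) p+a≤q+a)
    where
    x+a-a≡x : ∀ x → x + a + - a ≡ x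
    x+a-a≡x x = trans (+-assoc x a (- a)) (trans (cong (λ z → x + z) (+-inverseʳ a)) (+-identityʳ x))

  i≤+∣i∣ : ∀ i → i ℤ.≤ + ℤ.∣ i ∣
  i≤+∣i∣ (+ _)      = ℤ.≤-refl
  i≤+∣i∣ ℤ.-[1+ _ ] = ℤ.-≤+

  archimedean : ∀ p → ∃ λ K → p < ℕtoℚ K
  archimedean p@(mkℚ i d _) = K , p<K
    where
    K : ℕ
    K = suc ℤ.∣ i ∣
    p<K : p < ℕtoℚ K
    p<K rewrite ℕtoℚ≡mkℚ K = *<* (begin-strict
      i ℤ.* + 1        ≡⟨ ℤ.*-identityʳ i ⟩
      i                ≤⟨ i≤+∣i∣ i ⟩
      + ℤ.∣ i ∣        <⟨ ℤ.+<+ (ℕ.n<1+n ℤ.∣ i ∣) ⟩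
      + K              ≤⟨ ℤ.+≤+ (ℕ.m≤m*n K (suc d)) ⟩
      + K ℤ.* + suc d  ∎)
      where open ℤ.≤-Reasoning

  floor-multiple-from : ∀ {c d} → 0ℚ ≤ d → ∀ K → d < ℕtoℚ K * c →
    ∃ λ M → ℕtoℚ M * c ≤ d × d < ℕtoℚ (suc M) * c
  floor-multiple-from {c} d≥0 zero d<0 rewrite *-zeroˡ c = ⊥-elim (<⇒≱ d<0 d≥0)
  floor-multiple-from {c} {d} d≥0 (suc K) d<[K+1]c with ℕtoℚ K * c ≤? d
  ... | yes Kc≤d = K , Kc≤d , d<[K+1]c
  ... | no  Kc≰d = floor-multiple-from d≥0 K (≰⇒> Kc≰d)

  floor-multiple : ∀ {c d} → 0ℚ < c → 0ℚ ≤ d →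
    ∃ λ M → ℕtoℚ M * c ≤ d × d < ℕtoℚ (suc M) * c
  floor-multiple {c} {d} c>0 d≥0 =
    floor-multiple-from d≥0 K (subst (_< ℕtoℚ K * c) d/c*c≡d (*-monoˡ-<-pos c (proj₂ (archimedean (d * 1/ c)))))
    where
    instance
      c-positive : Positive c
      c-positive = positive c>0
      c-nonZero : NonZero c
      c-nonZero = pos⇒nonZero c
    K : ℕ
    K = proj₁ (archimedean (d * 1/ c))
    d/c*c≡d : d * 1/ c * c ≡ d
    d/c*c≡d = trans (*-assoc d (1/ c) c) (trans (cong (d *_) (*-inverseˡ c)) (*-identityʳ d))

  nonNeg*nonNeg : ∀ {a b} → 0ℚ ≤ a → 0ℚ ≤ b → 0ℚ ≤ a * b
  nonNeg*nonNeg {a} {b} a≥0 b≥0 =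
    nonNegative⁻¹ (a * b) {{nonNeg*nonNeg⇒nonNeg a {{nonNegative a≥0}} b {{nonNegative b≥0}}}}

  *-mono-≤-nonNeg : ∀ {a b c d} → 0ℚ ≤ a → a ≤ b → 0ℚ ≤ c → c ≤ d → a * c ≤ b * d
  *-mono-≤-nonNeg {a} {b} {c} {d} a≥0 a≤b c≥0 c≤d =
    ≤-trans (*-monoʳ-≤-nonNeg c {{nonNegative c≥0}} a≤b)
            (*-monoˡ-≤-nonNeg b {{nonNegative (≤-trans a≥0 a≤b)}} c≤d)

  ^ℚ-nonNeg : ∀ {q} k → 0ℚ ≤ q → 0ℚ ≤ q ^ℚ k
  ^ℚ-nonNeg zero    q≥0 = *≤* (ℤ.+≤+ ℕ.z≤n)
  ^ℚ-nonNeg (suc k) q≥0 = nonNeg*nonNeg q≥0 (^ℚ-nonNeg k q≥0)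

  ^ℚ-pos : ∀ {q} k → 0ℚ < q → 0ℚ < q ^ℚ k
  ^ℚ-pos zero        q>0 = *<* (ℤ.+<+ (ℕ.s≤s ℕ.z≤n))
  ^ℚ-pos {q} (suc k) q>0 =
    subst (_< q * q ^ℚ k) (*-zeroʳ q) (*-monoʳ-<-pos q {{positive q>0}} (^ℚ-pos k q>0))

  ^ℚ-mono-≤ : ∀ {p q} k → 0ℚ ≤ p → p ≤ q → p ^ℚ k ≤ q ^ℚ k
  ^ℚ-mono-≤ zero    p≥0 p≤q = ≤-refl
  ^ℚ-mono-≤ (suc k) p≥0 p≤q = *-mono-≤-nonNeg p≥0 p≤q (^ℚ-nonNeg k p≥0) (^ℚ-mono-≤ k p≥0 p≤q)

  ^ℚ-≤1 : ∀ {q} k → 0ℚ ≤ q → q ≤ 1ℚ → q ^ℚ k ≤ 1ℚ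
  ^ℚ-≤1 zero    q≥0 q≤1 = ≤-refl
  ^ℚ-≤1 (suc k) q≥0 q≤1 = *-mono-≤-nonNeg q≥0 q≤1 (^ℚ-nonNeg k q≥0) (^ℚ-≤1 k q≥0 q≤1)

  ^ℚ*^ℚ-≤ : ∀ {p q} r m → 0ℚ ≤ p → p ≤ q → q ≤ 1ℚ → p ^ℚ r * q ^ℚ m ≤ q ^ℚ r
  ^ℚ*^ℚ-≤ {p} {q} r m p≥0 p≤q q≤1 = begin
    p ^ℚ r * q ^ℚ m  ≤⟨ *-monoˡ-≤-nonNeg (p ^ℚ r) {{nonNegative (^ℚ-nonNeg r p≥0)}}
                          (^ℚ-≤1 m q≥0 q≤1) ⟩
    p ^ℚ r * 1ℚ      ≡⟨ *-identityʳ (p ^ℚ r) ⟩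
    p ^ℚ r           ≤⟨ ^ℚ-mono-≤ r p≥0 p≤q ⟩
    q ^ℚ r           ∎
    where
    open ≤-Reasoning
    q≥0 : 0ℚ ≤ q
    q≥0 = ≤-trans p≥0 p≤q

  complement-share : ∀ α a b {n} → a ℕ.+ b ≡ n → ℕtoℚ a ≤ α * ℕtoℚ n →
    (1ℚ - α) * ℕtoℚ n ≤ ℕtoℚ b
  complement-share α a b {n} a+b≡n a≤αn = +-cancelʳ-≤ (α * ℕtoℚ n) (begin
    (1ℚ - α) * ℕtoℚ n + α * ℕtoℚ n  ≡⟨ split α (ℕtoℚ n) ⟩
    ℕtoℚ n                          ≡⟨ cong ℕtoℚ a+b≡n ⟨
    ℕtoℚ (a ℕ.+ b)                  ≡⟨ ℕtoℚ-+ a b ⟩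
    ℕtoℚ a + ℕtoℚ b                 ≤⟨ +-monoˡ-≤ (ℕtoℚ b) a≤αn ⟩
    α * ℕtoℚ n + ℕtoℚ b             ≡⟨ +-comm (α * ℕtoℚ n) (ℕtoℚ b) ⟩
    ℕtoℚ b + α * ℕtoℚ n             ∎)
    where
    open ≤-Reasoning
    split : ∀ α x → (1ℚ - α) * x + α * x ≡ x
    split = solve 2 (λ α x → (con 1ℚ :- α) :* x :+ α :* x := x) refl

  scaled-count-≤ : ∀ {φ x} a a′ t → 0ℚ ≤ φ → φ ≤ 1ℚ → φ * ℕtoℚ a ≤ ℕtoℚ a′ →
    x ≤ ℕtoℚ (a ℕ.+ t) → φ * x ≤ ℕtoℚ (a′ ℕ.+ t)
  scaled-count-≤ {φ} {x} a a′ t φ≥0 φ≤1 φa≤a′ x≤a+t = begin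
    φ * x                    ≤⟨ *-monoˡ-≤-nonNeg φ {{nonNegative φ≥0}} x≤a+t ⟩
    φ * ℕtoℚ (a ℕ.+ t)       ≡⟨ cong (φ *_) (ℕtoℚ-+ a t) ⟩
    φ * (ℕtoℚ a + ℕtoℚ t)    ≡⟨ *-distribˡ-+ φ (ℕtoℚ a) (ℕtoℚ t) ⟩
    φ * ℕtoℚ a + φ * ℕtoℚ t  ≤⟨ +-mono-≤ φa≤a′ φt≤t ⟩
    ℕtoℚ a′ + ℕtoℚ t         ≡⟨ ℕtoℚ-+ a′ t ⟨
    ℕtoℚ (a′ ℕ.+ t)          ∎
    where
    open ≤-Reasoning
    φt≤t : φ * ℕtoℚ t ≤ ℕtoℚ t
    φt≤t = ≤-trans (*-monoʳ-≤-nonNeg (ℕtoℚ t) {{nonNegative (ℕtoℚ-nonNeg t)}} φ≤1)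
                   (≤-reflexive (*-identityˡ (ℕtoℚ t)))

  surplus-after-weighting : ∀ {w b c} v N → 0ℚ ≤ b → w ≤ 1ℚ → c ≤ w * b →
    ℕtoℚ (suc v) * b < ℕtoℚ (suc N) * c → ℕtoℚ v < w * ℕtoℚ N
  surplus-after-weighting {w} {b} {c} v N b≥0 w≤1 c≤wb [v+1]b<[N+1]c =
    +-cancelˡ-< 1ℚ (begin-strict
      1ℚ + ℕtoℚ v        ≡⟨ ℕtoℚ-+ 1 v ⟨
      ℕtoℚ (suc v)       <⟨ v+1<[N+1]w ⟩
      ℕtoℚ (suc N) * w   ≡⟨ cong (_* w) (ℕtoℚ-+ 1 N) ⟩
      (1ℚ + ℕtoℚ N) * w  ≡⟨ distribute w (ℕtoℚ N) ⟩
      w + w * ℕtoℚ N     ≤⟨ +-monoˡ-≤ (w * ℕtoℚ N) w≤1 ⟩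
      1ℚ + w * ℕtoℚ N    ∎)
    where
    open ≤-Reasoning
    distribute : ∀ w n → (1ℚ + n) * w ≡ w + w * n
    distribute = solve 2 (λ w n → (con 1ℚ :+ n) :* w := w :+ w :* n) refl
    v+1<[N+1]w : ℕtoℚ (suc v) < ℕtoℚ (suc N) * w
    v+1<[N+1]w = *-cancelʳ-<-nonNeg b {{nonNegative b≥0}} (begin-strict
      ℕtoℚ (suc v) * b        <⟨ [v+1]b<[N+1]c ⟩
      ℕtoℚ (suc N) * c        ≤⟨ *-monoˡ-≤-nonNeg (ℕtoℚ (suc N)) {{nonNegative (ℕtoℚ-nonNeg (suc N))}}
                                                     c≤wb ⟩
      ℕtoℚ (suc N) * (w * b)  ≡⟨ *-assoc (ℕtoℚ (suc N)) w b ⟨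
      ℕtoℚ (suc N) * w * b    ∎)

  moveFactor : ℚ → Move → ℚ
  moveFactor α skip           = 1ℚ
  moveFactor α (painted red)  = α
  moveFactor α (painted blue) = 1ℚ - α

  weight : ℚ → History → ℚ
  weight α []      = 1ℚ
  weight α (y ∷ h) = moveFactor α y * weight α h

  weight-∷ʳ : ∀ α h y → weight α (h ∷ʳ y) ≡ weight α h * moveFactor α y
  weight-∷ʳ α []      y = trans (*-identityʳ (moveFactor α y)) (sym (*-identityˡ (moveFactor α y)))
  weight-∷ʳ α (x ∷ h) y =
    trans (cong (moveFactor α x *_) (weight-∷ʳ α h y)) (sym (*-assoc (moveFactor α x) (weight α h) (moveFactor α y)))

  module _ {α : ℚ} (α≥0 : 0ℚ ≤ α) (α≤1-α : α ≤ 1ℚ - α) (1-α≤1 : 1ℚ - α ≤ 1ℚ) where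

    private
      β : ℚ
      β = 1ℚ - α
      β≥0 : 0ℚ ≤ β
      β≥0 = ≤-trans α≥0 α≤1-α

    moveFactor-bounds : ∀ y → 0ℚ ≤ moveFactor α y × moveFactor α y ≤ 1ℚ
    moveFactor-bounds skip           = ^ℚ-nonNeg 0 α≥0 , ≤-refl
    moveFactor-bounds (painted red)  = α≥0 , ≤-trans α≤1-α 1-α≤1
    moveFactor-bounds (painted blue) = β≥0 , 1-α≤1

    weight-≤1 : ∀ h → weight α h ≤ 1ℚ
    weight-≤1 []      = ≤-refl
    weight-≤1 (y ∷ h) with moveFactor-bounds y
    ... | f≥0 , f≤1 =
      ≤-trans (*-mono-≤-nonNeg f≥0 f≤1 (weight-≥0 h) (weight-≤1 h)) (≤-reflexive (*-identityˡ 1ℚ))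
      where
      weight-≥0 : ∀ h → 0ℚ ≤ weight α h
      weight-≥0 []      = ^ℚ-nonNeg 0 α≥0
      weight-≥0 (y ∷ h) = nonNeg*nonNeg (proj₁ (moveFactor-bounds y)) (weight-≥0 h)

    weight-≥ : ∀ h {r m} → redCount h ℕ.≤ r → edgeCount h ℕ.≤ m →
      α ^ℚ r * β ^ℚ m ≤ weight α h * β ^ℚ r
    weight-≥ [] {r} {m} _ _ =
      ≤-trans (^ℚ*^ℚ-≤ r m α≥0 α≤1-α 1-α≤1) (≤-reflexive (sym (*-identityˡ (β ^ℚ r))))
    weight-≥ (skip ∷ h) {r} {m} r′≤r m′≤m =
      subst (α ^ℚ r * β ^ℚ m ≤_) (cong (_* β ^ℚ r) (sym (*-identityˡ (weight α h))))
            (weight-≥ h r′≤r m′≤m)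
    weight-≥ (painted red ∷ h) {suc r} {suc m} (ℕ.s≤s r′≤r) (ℕ.s≤s m′≤m) = begin
      α * α ^ℚ r * (β * β ^ℚ m)      ≡⟨ shuffle α (α ^ℚ r) β (β ^ℚ m) ⟩
      α * β * (α ^ℚ r * β ^ℚ m)      ≤⟨ *-monoˡ-≤-nonNeg (α * β) {{nonNegative (nonNeg*nonNeg α≥0 β≥0)}}
                                                         (weight-≥ h r′≤r m′≤m) ⟩
      α * β * (weight α h * β ^ℚ r)  ≡⟨ shuffle α β (weight α h) (β ^ℚ r) ⟩
      α * weight α h * (β * β ^ℚ r)  ∎
      where
      open ≤-Reasoning
      shuffle : ∀ a b c d → a * b * (c * d) ≡ a * c * (b * d)
      shuffle = solve 4 (λ a b c d → (a :* b) :* (c :* d) := (a :* c) :* (b :* d)) refl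
    weight-≥ (painted blue ∷ h) {r} {suc m} r′≤r (ℕ.s≤s m′≤m) = begin
      α ^ℚ r * (β * β ^ℚ m)      ≡⟨ swap-front β (α ^ℚ r) (β ^ℚ m) ⟩
      β * (α ^ℚ r * β ^ℚ m)      ≤⟨ *-monoˡ-≤-nonNeg β {{nonNegative β≥0}} (weight-≥ h r′≤r m′≤m) ⟩
      β * (weight α h * β ^ℚ r)  ≡⟨ *-assoc β (weight α h) (β ^ℚ r) ⟨
      β * weight α h * β ^ℚ r    ∎
      where
      open ≤-Reasoning
      swap-front : ∀ b a c → a * (b * c) ≡ b * (a * c)
      swap-front = solve 3 (λ b a c → a :* (b :* c) := b :* (a :* c)) refl

open Arithmetic

module Plays where

  open import Data.Nat using (ℕ; zero; suc; _<_; _≤_; z≤n; s≤s)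

  pairAt-< : ∀ k → proj₁ (pairAt k) < proj₂ (pairAt k)
  pairAt-< zero    = s≤s z≤n
  pairAt-< (suc k) = nextPair-< (pairAt k)
    where
    nextPair-< : ∀ p → proj₁ (nextPair p) < proj₂ (nextPair p)
    nextPair-< (j , i) with suc j ℕ.<? i
    ... | yes j+1<i = j+1<i
    ... | no  _     = s≤s z≤n

  -- Vertex 0 counts as revealed before the first decision point.
  revealedAfter : ℕ → ℕ
  revealedAfter zero    = 1
  revealedAfter (suc k) = suc (proj₂ (pairAt k))

  revealedAfter-cases : ∀ k → revealedAfter k ≡ proj₂ (pairAt k) ⊎ revealedAfter k ≡ suc (proj₂ (pairAt k))
  revealedAfter-cases zero    = inj₁ refl
  revealedAfter-cases (suc k) = nextPair-cases (pairAt k)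
    where
    nextPair-cases : ∀ p → suc (proj₂ p) ≡ proj₂ (nextPair p) ⊎ suc (proj₂ p) ≡ suc (proj₂ (nextPair p))
    nextPair-cases (j , i) with suc j ℕ.<? i
    ... | yes _ = inj₂ refl
    ... | no  _ = inj₁ refl

  vertexCount≡revealedAfter : ∀ h → h ≢ [] → vertexCount h ≡ revealedAfter (length h)
  vertexCount≡revealedAfter []      h≢[] = ⊥-elim (h≢[] refl)
  vertexCount≡revealedAfter (_ ∷ _) _    = refl

  length-∷ʳ : ∀ {A : Set} (xs : List A) x → length (xs ∷ʳ x) ≡ suc (length xs)
  length-∷ʳ xs x = trans (length-++ xs) (ℕ.+-comm (length xs) 1)

  lookup-∷ʳ : ∀ {A : Set} (xs : List A) y (k : Fin (length (xs ∷ʳ y))) →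
    (Σ (Fin (length xs)) λ k′ → toℕ k′ ≡ toℕ k × lookup xs k′ ≡ lookup (xs ∷ʳ y) k)
    ⊎ (toℕ k ≡ length xs × lookup (xs ∷ʳ y) k ≡ y)
  lookup-∷ʳ []       y fzero    = inj₂ (refl , refl)
  lookup-∷ʳ (x ∷ xs) y fzero    = inj₁ (fzero , refl , refl)
  lookup-∷ʳ (x ∷ xs) y (fsuc k) with lookup-∷ʳ xs y k
  ... | inj₁ (k′ , k′≡k , lookup≡) = inj₁ (fsuc k′ , cong suc k′≡k , lookup≡)
  ... | inj₂ (k≡len , lookup≡)     = inj₂ (cong suc k≡len , lookup≡)

  HasEdge-[] : ∀ {c j i} → ¬ HasEdge [] c j i
  HasEdge-[] (() , _)

  HasEdge-∷ʳ : ∀ h y {c j i} → HasEdge (h ∷ʳ y) c j i →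
    HasEdge h c j i ⊎ (pairAt (length h) ≡ (j , i) × y ≡ painted c)
  HasEdge-∷ʳ h y (k , pair≡ , move≡) with lookup-∷ʳ h y k
  ... | inj₁ (k′ , k′≡k , lookup≡) = inj₁ (k′ , trans (cong pairAt k′≡k) pair≡ , trans lookup≡ move≡)
  ... | inj₂ (k≡len , lookup≡)     = inj₂ (trans (cong pairAt (sym k≡len)) pair≡ , trans (sym lookup≡) move≡)

  copy-played : ∀ {h c k} {H : OGraph (suc (suc k))} → adj H fzero (fsuc fzero) ≡ true →
    HasOrderedCopy h c H → h ≢ []
  copy-played hub (_ , _ , edges) refl = HasEdge-[] (edges fzero (fsuc fzero) (s≤s z≤n) hub)

  StrictlyMonotone : ∀ {k} → (Fin k → ℕ) → Set
  StrictlyMonotone f = ∀ a b → toℕ a < toℕ b → f a < f b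

  strictlyMonotone-reflects-< : ∀ {k} {f : Fin k → ℕ} → StrictlyMonotone f →
    ∀ a b → f a < f b → toℕ a < toℕ b
  strictlyMonotone-reflects-< mono a b fa<fb with ℕ.<-cmp (toℕ a) (toℕ b)
  ... | tri< a<b _ _ = a<b
  ... | tri≈ _ a≡b _ rewrite Fin.toℕ-injective a≡b = ⊥-elim (ℕ.<-irrefl refl fa<fb)
  ... | tri> _ _ b<a = ⊥-elim (ℕ.<-asym fa<fb (mono b a b<a))

  strictlyMonotone⇒injective : ∀ {k} {f : Fin k → ℕ} → StrictlyMonotone f → Injective _≡_ _≡_ f
  strictlyMonotone⇒injective mono {a} {b} fa≡fb with ℕ.<-cmp (toℕ a) (toℕ b)
  ... | tri< a<b _ _ = ⊥-elim (ℕ.<-irrefl fa≡fb (mono a b a<b))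
  ... | tri≈ _ a≡b _ = Fin.toℕ-injective a≡b
  ... | tri> _ _ b<a = ⊥-elim (ℕ.<-irrefl (sym fa≡fb) (mono b a b<a))

open Plays

sorted-triples⇒Contains : {U V : Set} (F : 3Graph U) (G : 3Graph V) (key : U → ℕ.ℕ) →
  Injective _≡_ _≡_ key → (ψ : U → V) → Injective _≡_ _≡_ ψ →
  (∀ x y z → key x ℕ.< key y → key y ℕ.< key z → edge F x y z ≡ true → edge G (ψ x) (ψ y) (ψ z) ≡ true) →
  Contains F G
sorted-triples⇒Contains {U} F G key key-injective ψ ψ-injective sorted = ψ , ψ-injective , transport
  where
  Transported : U → U → U → Set
  Transported x y z = edge F x y z ≡ true → edge G (ψ x) (ψ y) (ψ z) ≡ true
  swap₁ : ∀ {x y z} → Transported x y z → Transported y x z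
  swap₁ {x} {y} {z} t e = trans (sym (sym₁ G (ψ x) (ψ y) (ψ z))) (t (trans (sym₁ F x y z) e))
  swap₂ : ∀ {x y z} → Transported x y z → Transported x z y
  swap₂ {x} {y} {z} t e = trans (sym (sym₂ G (ψ x) (ψ y) (ψ z))) (t (trans (sym₂ F x y z) e))
  transport : ∀ x y z → Distinct3 x y z → Transported x y z
  transport x y z (x≢y , x≢z , y≢z)
    with ℕ.<-cmp (key x) (key y) | ℕ.<-cmp (key x) (key z) | ℕ.<-cmp (key y) (key z)
  ... | tri≈ _ e _  | _           | _           = ⊥-elim (x≢y (key-injective e))
  ... | _           | tri≈ _ e _  | _           = ⊥-elim (x≢z (key-injective e))
  ... | _           | _           | tri≈ _ e _  = ⊥-elim (y≢z (key-injective e))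
  ... | tri< xy _ _ | _           | tri< yz _ _ = sorted x y z xy yz
  ... | tri< _ _ _  | tri< xz _ _ | tri> _ _ zy = swap₂ (sorted x z y xz zy)
  ... | tri< xy _ _ | tri> _ _ zx | tri> _ _ _  = swap₂ (swap₁ (sorted z x y zx xy))
  ... | tri> _ _ yx | tri< xz _ _ | _           = swap₁ (sorted y x z yx xz)
  ... | tri> _ _ _  | tri> _ _ zx | tri< yz _ _ = swap₁ (swap₂ (sorted y z x yz zx))
  ... | tri> _ _ yx | _           | tri> _ _ zy = swap₁ (swap₂ (swap₁ (sorted z y x zy yx)))

∈-filterᵇ⁻ : ∀ {A : Set} (p : A → Bool) {xs x} → x ∈ filterᵇ p xs → x ∈ xs × p x ≡ true
∈-filterᵇ⁻ p x∈ with ∈-filter⁻ (T? ∘ p) x∈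
... | x∈xs , px = x∈xs , Equivalence.to T-≡ px

length-filterᵇ-partition : ∀ {A : Set} (p : A → Bool) xs →
  length (filterᵇ p xs) ℕ.+ length (filterᵇ (not ∘ p) xs) ≡ length xs
length-filterᵇ-partition p []       = refl
length-filterᵇ-partition p (x ∷ xs) with p x
... | true  = cong ℕ.suc (length-filterᵇ-partition p xs)
... | false = trans (ℕ.+-suc _ _) (cong ℕ.suc (length-filterᵇ-partition p xs))

colourGraph : ∀ {V : Set} → 3Graph V → Colour → 3Graph V
colourGraph G red  = G
colourGraph G blue = complement G

module ReservoirPainter {N : ℕ.ℕ} (G : 3Graph (Fin (ℕ.suc N))) (α : ℚ.ℚ) where

  open import Data.Nat using (ℕ; zero; suc; _<_; _≤_; _≟_; z≤n; s≤s)
  open import Data.Rational using (ℚ; 0ℚ; 1ℚ)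

  V : Set
  V = Fin (suc N)

  record State : Set where
    constructor state
    field
      revealed  : ℕ
      embed     : ℕ → V
      reservoir : List V
  open State public

  _[_↦_] : (ℕ → V) → ℕ → V → ℕ → V
  (f [ t ↦ a ]) b with b ≟ t
  ... | yes _ = a
  ... | no  _ = f b

  [↦]-cases : ∀ f t a {b} → b < suc t → (b < t × (f [ t ↦ a ]) b ≡ f b) ⊎ (b ≡ t × (f [ t ↦ a ]) b ≡ a)
  [↦]-cases f t a {b} b<1+t with b ≟ t | ℕ.m<1+n⇒m<n∨m≡n b<1+t
  ... | yes b≡t | _       = inj₂ (b≡t , refl)
  ... | no  b≢t | inj₁ b<t = inj₁ (b<t , refl)
  ... | no  b≢t | inj₂ b≡t = ⊥-elim (b≢t b≡t)

  -- With an empty reservoir the new vertex is sent to a junk vertex; no invariant is claimed then.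
  embedNext : State → State
  embedNext (state t f [])      = state (suc t) (f [ t ↦ fzero ]) []
  embedNext (state t f (a ∷ S)) = state (suc t) (f [ t ↦ a ]) S

  reveal : State → ℕ → State
  reveal σ i with revealed σ ≟ i
  ... | yes _ = embedNext σ
  ... | no  _ = σ

  reveal-cases : ∀ σ i → (revealed σ ≡ i × reveal σ i ≡ embedNext σ) ⊎ (revealed σ ≢ i × reveal σ i ≡ σ)
  reveal-cases σ i with revealed σ ≟ i
  ... | yes t≡i = inj₁ (t≡i , refl)
  ... | no  t≢i = inj₂ (t≢i , refl)

  revealed-embedNext : ∀ σ → revealed (embedNext σ) ≡ suc (revealed σ)
  revealed-embedNext (state t f [])      = refl
  revealed-embedNext (state t f (_ ∷ _)) = refl

  size : State → ℕ
  size σ = length (reservoir σ) ℕ.+ revealed σ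

  size-embedNext : ∀ σ → size σ ≤ size (embedNext σ)
  size-embedNext (state t f [])      = ℕ.n≤1+n t
  size-embedNext (state t f (_ ∷ S)) = ℕ.≤-reflexive (sym (ℕ.+-suc (length S) t))

  embedNext-⊆ : ∀ σ {x} → x ∈ reservoir (embedNext σ) → x ∈ reservoir σ
  embedNext-⊆ (state t f (_ ∷ _)) x∈S = there x∈S

  embedNext-unique : ∀ σ → Unique (reservoir σ) → Unique (reservoir (embedNext σ))
  embedNext-unique (state t f [])      _          = []
  embedNext-unique (state t f (_ ∷ _)) (_ ∷ uniq) = uniq

  Later : State → ℕ → V → Set
  Later σ i x = x ∈ reservoir σ ⊎ ∃[ i′ ] i < i′ × i′ < revealed σ × embed σ i′ ≡ x

  Linked : State → Colour → ℕ → ℕ → Set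
  Linked σ c j i = ∀ {x} → Later σ i x → edge (colourGraph G c) (embed σ j) (embed σ i) x ≡ true

  record Faithful (σ : State) (h : History) : Set where
    field
      embed-injective : ∀ {a b} → a < revealed σ → b < revealed σ → embed σ a ≡ embed σ b → a ≡ b
      reservoir-fresh : ∀ {a x} → a < revealed σ → x ∈ reservoir σ → embed σ a ≢ x
      edge-linked     : ∀ {c j i} → HasEdge h c j i → j < i × i < revealed σ × Linked σ c j i
  open Faithful

  embedNext-faithful : ∀ σ {h} → Unique (reservoir σ) → ∃ (_∈ reservoir (embedNext σ)) →
    Faithful σ h → Faithful (embedNext σ) h
  embedNext-faithful (state t f [])      _                 (_ , ())
  embedNext-faithful (state t f (a ∷ S)) {h} (a∉S ∷ _) _ φ = record
    { embed-injective = injective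
    ; reservoir-fresh = fresh
    ; edge-linked     = linked }
    where
    σ  = state t f (a ∷ S)
    f′ = f [ t ↦ a ]
    injective : ∀ {b b′} → b < suc t → b′ < suc t → f′ b ≡ f′ b′ → b ≡ b′
    injective {b} {b′} b<1+t b′<1+t f′b≡f′b′ with [↦]-cases f t a b<1+t | [↦]-cases f t a b′<1+t
    ... | inj₁ (b<t , e) | inj₁ (b′<t , e′) = embed-injective φ b<t b′<t (trans (sym e) (trans f′b≡f′b′ e′))
    ... | inj₁ (b<t , e) | inj₂ (_ , e′)    =
      ⊥-elim (reservoir-fresh φ b<t (here refl) (trans (sym e) (trans f′b≡f′b′ e′)))
    ... | inj₂ (_ , e)   | inj₁ (b′<t , e′) =
      ⊥-elim (reservoir-fresh φ b′<t (here refl) (trans (sym e′) (trans (sym f′b≡f′b′) e)))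
    ... | inj₂ (b≡t , _) | inj₂ (b′≡t , _)  = trans b≡t (sym b′≡t)
    fresh : ∀ {b x} → b < suc t → x ∈ S → f′ b ≢ x
    fresh b<1+t x∈S with [↦]-cases f t a b<1+t
    ... | inj₁ (b<t , e) = reservoir-fresh φ b<t (there x∈S) ∘ trans (sym e)
    ... | inj₂ (_ , e)   = All.lookup a∉S x∈S ∘ trans (sym e)
    later : ∀ {i x} → Later (embedNext σ) i x → Later σ i x
    later (inj₁ x∈S) = inj₁ (there x∈S)
    later (inj₂ (i′ , i<i′ , i′<1+t , f′i′≡x)) with [↦]-cases f t a i′<1+t
    ... | inj₁ (i′<t , e) = inj₂ (i′ , i<i′ , i′<t , trans (sym e) f′i′≡x)
    ... | inj₂ (_ , e)    = inj₁ (here (trans (sym f′i′≡x) e))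
    linked : ∀ {c j i} → HasEdge h c j i → j < i × i < suc t × Linked (embedNext σ) c j i
    linked {c} {j} {i} e with edge-linked φ e
    ... | j<i , i<t , link
      with [↦]-cases f t a (ℕ.m<n⇒m<1+n (ℕ.<-trans j<i i<t)) | [↦]-cases f t a (ℕ.m<n⇒m<1+n i<t)
    ...   | inj₁ (_ , fj≡) | inj₁ (_ , fi≡) = j<i , ℕ.m<n⇒m<1+n i<t , λ {x} later′ →
              subst₂ (λ u v → edge (colourGraph G c) u v x ≡ true) (sym fj≡) (sym fi≡) (link (later later′))
    ...   | inj₂ (j≡t , _) | _              = ⊥-elim (ℕ.<-irrefl j≡t (ℕ.<-trans j<i i<t))
    ...   | _              | inj₂ (i≡t , _) = ⊥-elim (ℕ.<-irrefl i≡t i<t)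

  paint : State → ℕ × ℕ → Colour → State
  paint σ (j , i) c =
    record σ { reservoir = filterᵇ (edge (colourGraph G c) (embed σ j) (embed σ i)) (reservoir σ) }

  applyMove : State → ℕ × ℕ → Move → State
  applyMove σ p skip        = σ
  applyMove σ p (painted c) = paint σ p c

  RedShare≥α : State → ℕ × ℕ → Set
  RedShare≥α σ p = α ℚ.* ℕtoℚ (length (reservoir σ)) ℚ.≤ ℕtoℚ (length (reservoir (paint σ p red)))

  colourFor : ∀ {P : Set} → Dec P → Colour
  colourFor (yes _) = red
  colourFor (no  _) = blue

  redShare≥α? : ∀ σ p → Dec (RedShare≥α σ p)
  redShare≥α? σ p = α ℚ.* ℕtoℚ (length (reservoir σ)) ℚ.≤? ℕtoℚ (length (reservoir (paint σ p red)))

  choose : State → ℕ × ℕ → Colour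
  choose σ p = colourFor (redShare≥α? σ p)

  applyMove-faithful : ∀ σ h y {j i} → pairAt (length h) ≡ (j , i) → revealed σ ≡ suc i →
    Faithful σ h → Faithful (applyMove σ (j , i) y) (h ∷ʳ y)
  applyMove-faithful σ h skip _ _ φ = record
    { embed-injective = embed-injective φ
    ; reservoir-fresh = reservoir-fresh φ
    ; edge-linked     = linked }
    where
    linked : ∀ {c j i} → HasEdge (h ∷ʳ skip) c j i → j < i × i < revealed σ × Linked σ c j i
    linked e with HasEdge-∷ʳ h skip e
    ... | inj₁ e′      = edge-linked φ e′
    ... | inj₂ (_ , ())
  applyMove-faithful σ h (painted c) {j} {i} pair≡ t≡1+i φ = record
    { embed-injective = embed-injective φ
    ; reservoir-fresh = λ a<t x∈S′ → reservoir-fresh φ a<t (proj₁ (kept x∈S′))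
    ; edge-linked     = linked }
    where
    σ′ = paint σ (j , i) c
    keep = edge (colourGraph G c) (embed σ j) (embed σ i)
    kept : ∀ {x} → x ∈ reservoir σ′ → x ∈ reservoir σ × keep x ≡ true
    kept = ∈-filterᵇ⁻ keep
    later : ∀ {i x} → Later σ′ i x → Later σ i x
    later (inj₁ x∈S′) = inj₁ (proj₁ (kept x∈S′))
    later (inj₂ i′)   = inj₂ i′
    new : Linked σ′ c j i
    new (inj₁ x∈S′) = proj₂ (kept x∈S′)
    new (inj₂ (i′ , i<i′ , i′<t , _)) =
      ⊥-elim (ℕ.<-irrefl refl (ℕ.<-≤-trans i<i′ (ℕ.≤-pred (subst (i′ <_) t≡1+i i′<t))))
    linked : ∀ {c′ j′ i′} → HasEdge (h ∷ʳ painted c) c′ j′ i′ →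
      j′ < i′ × i′ < revealed σ × Linked σ′ c′ j′ i′
    linked e with HasEdge-∷ʳ h (painted c) e
    ... | inj₁ e′ with edge-linked φ e′
    ...   | j<i , i<t , link = j<i , i<t , link ∘ later
    linked e | inj₂ (pair≡′ , refl) with trans (sym pair≡) pair≡′
    ... | refl = subst₂ _<_ (cong proj₁ pair≡) (cong proj₂ pair≡) (pairAt-< (length h)) ,
                 subst (i <_) (sym t≡1+i) (ℕ.n<1+n i) , new

  applyMove-⊆ : ∀ σ p y {x} → x ∈ reservoir (applyMove σ p y) → x ∈ reservoir σ
  applyMove-⊆ σ p           skip        x∈S′ = x∈S′
  applyMove-⊆ σ (j , i) (painted c) x∈S′ =
    proj₁ (∈-filterᵇ⁻ (edge (colourGraph G c) (embed σ j) (embed σ i)) x∈S′)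

  applyMove-unique : ∀ σ p y → Unique (reservoir σ) → Unique (reservoir (applyMove σ p y))
  applyMove-unique σ p       skip        uniq = uniq
  applyMove-unique σ (j , i) (painted c) uniq =
    Unique.filter⁺ (T? ∘ edge (colourGraph G c) (embed σ j) (embed σ i)) uniq

  revealed-applyMove : ∀ σ p y → revealed (applyMove σ p y) ≡ revealed σ
  revealed-applyMove σ p skip        = refl
  revealed-applyMove σ p (painted c) = refl

  colourFor-share : ∀ σ p (d : Dec (RedShare≥α σ p)) →
    moveFactor α (painted (colourFor d)) ℚ.* ℕtoℚ (length (reservoir σ))
      ℚ.≤ ℕtoℚ (length (reservoir (paint σ p (colourFor d))))
  colourFor-share σ p       (yes αS≤R) = αS≤R
  colourFor-share σ (j , i) (no  αS≰R) =
    complement-share α (length (reservoir (paint σ (j , i) red))) (length (reservoir (paint σ (j , i) blue)))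
      (length-filterᵇ-partition (edge G (embed σ j) (embed σ i)) (reservoir σ)) (ℚ.<⇒≤ (ℚ.≰⇒> αS≰R))

  data Reply (σ : State) (p : ℕ × ℕ) : Move → Set where
    skips  : Reply σ p skip
    paints : Reply σ p (painted (choose σ p))

  reply-share : ∀ {σ p y} → Reply σ p y →
    moveFactor α y ℚ.* ℕtoℚ (length (reservoir σ)) ℚ.≤ ℕtoℚ (length (reservoir (applyMove σ p y)))
  reply-share {σ} skips = ℚ.≤-reflexive (ℚ.*-identityˡ _)
  reply-share {σ} {p} paints = colourFor-share σ p (redShare≥α? σ p)

  step : State → ℕ → Move → State
  step σ k y = applyMove (reveal σ (proj₂ (pairAt k))) (pairAt k) y

  simulateFrom : ℕ → State → History → State
  simulateFrom k σ []      = σ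
  simulateFrom k σ (y ∷ h) = simulateFrom (suc k) (step σ k y) h

  simulateFrom-∷ʳ : ∀ k σ h y → simulateFrom k σ (h ∷ʳ y) ≡ step (simulateFrom k σ h) (k ℕ.+ length h) y
  simulateFrom-∷ʳ k σ []      y = cong (λ k′ → step σ k′ y) (sym (ℕ.+-identityʳ k))
  simulateFrom-∷ʳ k σ (x ∷ h) y =
    trans (simulateFrom-∷ʳ (suc k) (step σ k x) h y)
          (cong (λ k′ → step (simulateFrom (suc k) (step σ k x) h) k′ y) (sym (ℕ.+-suc k (length h))))

  initial : State
  initial = state 1 (λ _ → fzero) (tabulate fsuc)

  simulate : History → State
  simulate = simulateFrom 0 initial

  painter : PainterStrategy
  painter h = choose (reveal (simulate h) (proj₂ (pairAt (length h)))) (pairAt (length h))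

  record Sound (σ : State) (h : History) : Set where
    field
      unique        : Unique (reservoir σ)
      faithful      : ∃ (_∈ reservoir σ) → Faithful σ h
      weighted-size : weight α h ℚ.* ℕtoℚ (suc N) ℚ.≤ ℕtoℚ (size σ)
  open Sound public

  record Invariant (σ : State) (h : History) : Set where
    field
      revealed≡ : revealed σ ≡ revealedAfter (length h)
      sound     : Sound σ h
  open Invariant public

  initial-invariant : Invariant initial []
  initial-invariant = record
    { revealed≡ = refl
    ; sound     = record
      { unique        = Unique.tabulate⁺ Fin.suc-injective
      ; faithful      = λ _ → record
        { embed-injective = λ { (s≤s z≤n) (s≤s z≤n) _ → refl }
        ; reservoir-fresh = λ { (s≤s z≤n) x∈S 0≡x → Fin.0≢1+n (trans 0≡x (proj₂ (∈-tabulate⁻ x∈S))) }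
        ; edge-linked     = λ e → ⊥-elim (HasEdge-[] e) }
      ; weighted-size = ℚ.≤-reflexive (trans (ℚ.*-identityˡ (ℕtoℚ (suc N)))
          (cong ℕtoℚ (trans (ℕ.+-comm 1 N) (cong (ℕ._+ 1) (sym (length-tabulate fsuc)))))) } }

  embedNext-sound : ∀ σ {h} → Sound σ h → Sound (embedNext σ) h
  embedNext-sound σ sound = record
    { unique        = embedNext-unique σ (unique sound)
    ; faithful      = λ (x , x∈S′) →
        embedNext-faithful σ (unique sound) (x , x∈S′) (faithful sound (x , embedNext-⊆ σ x∈S′))
    ; weighted-size = ℚ.≤-trans (weighted-size sound) (ℕtoℚ-mono-≤ (size-embedNext σ)) }

  reveal-sound : ∀ σ i {h} → revealed σ ≡ i ⊎ revealed σ ≡ suc i → Sound σ h →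
    revealed (reveal σ i) ≡ suc i × Sound (reveal σ i) h
  reveal-sound σ i t≈i sound with reveal-cases σ i
  ... | inj₁ (t≡i , σ′≡) rewrite σ′≡ = trans (revealed-embedNext σ) (cong suc t≡i) , embedNext-sound σ sound
  ... | inj₂ (t≢i , σ′≡) rewrite σ′≡ = [ ⊥-elim ∘ t≢i , (λ t≡1+i → t≡1+i) ]′ t≈i , sound

  module _ (α≥0 : 0ℚ ℚ.≤ α) (α≤1-α : α ℚ.≤ 1ℚ ℚ.- α) (1-α≤1 : 1ℚ ℚ.- α ℚ.≤ 1ℚ) where

    applyMove-sound : ∀ σ h y {j i} → pairAt (length h) ≡ (j , i) → revealed σ ≡ suc i → Reply σ (j , i) y →
      Sound σ h → Sound (applyMove σ (j , i) y) (h ∷ʳ y)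
    applyMove-sound σ h y {j} {i} pair≡ t≡1+i reply sound = record
      { unique        = applyMove-unique σ (j , i) y (unique sound)
      ; faithful      = λ (x , x∈S′) →
          applyMove-faithful σ h y pair≡ t≡1+i (faithful sound (x , applyMove-⊆ σ (j , i) y x∈S′))
      ; weighted-size = begin
          weight α (h ∷ʳ y) ℚ.* M          ≡⟨ cong (ℚ._* M) (weight-∷ʳ α h y) ⟩
          weight α h ℚ.* φ ℚ.* M           ≡⟨ rotate (weight α h) φ M ⟩
          φ ℚ.* (weight α h ℚ.* M)         ≤⟨ scaled-count-≤ (length (reservoir σ)) (length S′) (revealed σ)
                                                φ≥0 φ≤1 (reply-share reply) (weighted-size sound) ⟩
          ℕtoℚ (length S′ ℕ.+ revealed σ)  ≡⟨ cong (λ t → ℕtoℚ (length S′ ℕ.+ t))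
                                                  (revealed-applyMove σ (j , i) y) ⟨
          ℕtoℚ (size (applyMove σ (j , i) y)) ∎ }
      where
      open ℚ.≤-Reasoning
      open Solver.+-*-Solver
      M φ : ℚ
      M = ℕtoℚ (suc N)
      φ = moveFactor α y
      S′ : List V
      S′ = reservoir (applyMove σ (j , i) y)
      φ≥0 : 0ℚ ℚ.≤ φ
      φ≥0 = proj₁ (moveFactor-bounds α≥0 α≤1-α 1-α≤1 y)
      φ≤1 : φ ℚ.≤ 1ℚ
      φ≤1 = proj₂ (moveFactor-bounds α≥0 α≤1-α 1-α≤1 y)
      rotate : ∀ w φ m → w ℚ.* φ ℚ.* m ≡ φ ℚ.* (w ℚ.* m)
      rotate = solve 3 (λ w φ m → w :* φ :* m := φ :* (w :* m)) refl

    invariant-step : ∀ {σ h y} → Reply (reveal σ (proj₂ (pairAt (length h)))) (pairAt (length h)) y →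
      Invariant σ h → Invariant (step σ (length h) y) (h ∷ʳ y)
    invariant-step {σ} {h} {y} reply inv = record
      { revealed≡ = trans (revealed-applyMove σ′ p y)
                          (trans (proj₁ revealed′) (cong revealedAfter (sym (length-∷ʳ h y))))
      ; sound     = applyMove-sound σ′ h y refl (proj₁ revealed′) reply (proj₂ revealed′) }
      where
      p : ℕ × ℕ
      p = pairAt (length h)
      σ′ : State
      σ′ = reveal σ (proj₂ p)
      revealed′ : revealed σ′ ≡ suc (proj₂ p) × Sound σ′ h
      revealed′ = reveal-sound σ (proj₂ p)
        (Sum.map (trans (revealed≡ inv)) (trans (revealed≡ inv)) (revealedAfter-cases (length h))) (sound inv)

    play-invariant : ∀ B L → Invariant (simulate (play B painter L)) (play B painter L)
    play-invariant B zero    = initial-invariant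
    play-invariant B (suc L) =
      subst (λ σ → Invariant σ (h ∷ʳ y)) (sym (simulateFrom-∷ʳ 0 initial h y))
            (invariant-step (reply (B h)) (play-invariant B L))
      where
      h = play B painter L
      y = if B h then painted (painter h) else skip
      reply : ∀ b → Reply (reveal (simulate h) (proj₂ (pairAt (length h)))) (pairAt (length h))
                          (if b then painted (painter h) else skip)
      reply true  = paints
      reply false = skips

  module Extraction {σ : State} {h : History} (φ : Faithful σ h) {w : V} (w∈S : w ∈ reservoir σ) where

    private
      R = revealed σ

    -- Position R stands for the reservoir vertex w, which every linked edge sees.
    at : ℕ → V
    at t with t ℕ.<? R
    ... | yes _ = embed σ t
    ... | no  _ = w

    at-cases : ∀ {t} → t ≤ R → (t < R × at t ≡ embed σ t) ⊎ (t ≡ R × at t ≡ w)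
    at-cases {t} t≤R with t ℕ.<? R
    ... | yes t<R = inj₁ (t<R , refl)
    ... | no  t≮R = inj₂ (ℕ.≤∧≮⇒≡ t≤R t≮R , refl)

    at-injective : ∀ {t t′} → t ≤ R → t′ ≤ R → at t ≡ at t′ → t ≡ t′
    at-injective t≤R t′≤R e with at-cases t≤R | at-cases t′≤R
    ... | inj₁ (t<R , a) | inj₁ (t′<R , a′) = embed-injective φ t<R t′<R (trans (sym a) (trans e a′))
    ... | inj₁ (t<R , a) | inj₂ (_ , a′)    = ⊥-elim (reservoir-fresh φ t<R w∈S (trans (sym a) (trans e a′)))
    ... | inj₂ (_ , a)   | inj₁ (t′<R , a′) =
      ⊥-elim (reservoir-fresh φ t′<R w∈S (trans (sym a′) (trans (sym e) a)))
    ... | inj₂ (t≡R , _) | inj₂ (t′≡R , _)  = trans t≡R (sym t′≡R)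

    at-linked : ∀ {c j i t} → HasEdge h c j i → i < t → t ≤ R →
      edge (colourGraph G c) (at j) (at i) (at t) ≡ true
    at-linked {c} {j} {i} {t} e i<t t≤R with edge-linked φ e
    ... | j<i , i<R , link with at-cases (ℕ.<⇒≤ (ℕ.<-trans j<i i<R)) | at-cases (ℕ.<⇒≤ i<R)
    ...   | inj₂ (j≡R , _) | _ = ⊥-elim (ℕ.<-irrefl j≡R (ℕ.<-trans j<i i<R))
    ...   | _ | inj₂ (i≡R , _) = ⊥-elim (ℕ.<-irrefl i≡R i<R)
    ...   | inj₁ (_ , aj) | inj₁ (_ , ai) rewrite aj | ai with at-cases t≤R
    ...     | inj₁ (t<R , at≡) =
      subst (λ x → edge (colourGraph G c) _ _ x ≡ true) (sym at≡) (link (inj₂ (t , i<t , t<R , refl)))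
    ...     | inj₂ (_ , at≡)   =
      subst (λ x → edge (colourGraph G c) _ _ x ≡ true) (sym at≡) (link (inj₁ w∈S))

    contains-from-positions : ∀ {U : Set} (F : 3Graph U) c (pos : U → ℕ) → Injective _≡_ _≡_ pos →
      (∀ u → pos u ≤ R) →
      (∀ x y z → pos x < pos y → pos y < pos z → edge F x y z ≡ true → HasEdge h c (pos x) (pos y)) →
      Contains F (colourGraph G c)
    contains-from-positions F c pos pos-injective pos≤R edges =
      sorted-triples⇒Contains F (colourGraph G c) pos pos-injective (at ∘ pos)
        (λ e → pos-injective (at-injective (pos≤R _) (pos≤R _) e))
        (λ x y z x<y y<z e → at-linked (edges x y z x<y y<z e) y<z (pos≤R z))

    copy-revealed : ∀ {c k} {H : OGraph (suc (suc k))} → (∀ b → adj H fzero (fsuc b) ≡ true) →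
      ((f , _) : HasOrderedCopy h c H) → ∀ a → f a < R
    copy-revealed hub (f , _ , edges) fzero =
      ℕ.<-trans (proj₁ (edge-linked φ (edges fzero (fsuc fzero) (s≤s z≤n) (hub fzero))))
                (proj₁ (proj₂ (edge-linked φ (edges fzero (fsuc fzero) (s≤s z≤n) (hub fzero)))))
    copy-revealed hub (f , _ , edges) (fsuc b) =
      proj₁ (proj₂ (edge-linked φ (edges fzero (fsuc b) (s≤s z≤n) (hub b))))

    -- The star's centre becomes u; its leaves together with w span the K_s.
    LK-from-redStar : ∀ {s} → HasOrderedCopy h red (ForwardStar (suc (suc s))) → Contains (LK (suc (suc s))) G
    LK-from-redStar {s} copy@(f , mono , edges) =
      contains-from-positions (LK (suc (suc s))) red pos pos-injective pos≤R sorted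
      where
      f<R = copy-revealed (λ _ → refl) copy
      f-injective = strictlyMonotone⇒injective mono
      pos : Fin (suc (suc (suc s))) → ℕ
      pos fzero             = f fzero
      pos (fsuc fzero)      = R
      pos (fsuc (fsuc b))   = f (fsuc b)
      pos≤R : ∀ u → pos u ≤ R
      pos≤R fzero           = ℕ.<⇒≤ (f<R fzero)
      pos≤R (fsuc fzero)    = ℕ.≤-refl
      pos≤R (fsuc (fsuc b)) = ℕ.<⇒≤ (f<R (fsuc b))
      centre-least : ∀ u → f fzero ≤ pos u
      centre-least fzero           = ℕ.≤-refl
      centre-least (fsuc fzero)    = ℕ.<⇒≤ (f<R fzero)
      centre-least (fsuc (fsuc b)) = ℕ.<⇒≤ (mono fzero (fsuc b) (s≤s z≤n))
      pos-injective : Injective _≡_ _≡_ pos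
      pos-injective {fzero}           {fzero}           _ = refl
      pos-injective {fzero}           {fsuc fzero}      e = ⊥-elim (ℕ.<-irrefl e (f<R fzero))
      pos-injective {fzero}           {fsuc (fsuc b)}   e with f-injective e
      ... | ()
      pos-injective {fsuc fzero}      {fzero}           e = ⊥-elim (ℕ.<-irrefl (sym e) (f<R fzero))
      pos-injective {fsuc fzero}      {fsuc fzero}      _ = refl
      pos-injective {fsuc fzero}      {fsuc (fsuc b)}   e = ⊥-elim (ℕ.<-irrefl (sym e) (f<R (fsuc b)))
      pos-injective {fsuc (fsuc a)}   {fzero}           e with f-injective e
      ... | ()
      pos-injective {fsuc (fsuc a)}   {fsuc fzero}      e = ⊥-elim (ℕ.<-irrefl e (f<R (fsuc a)))
      pos-injective {fsuc (fsuc a)}   {fsuc (fsuc b)}   e = cong fsuc (f-injective e)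
      sorted : ∀ x y z → pos x < pos y → pos y < pos z → edge (LK (suc (suc s))) x y z ≡ true →
        HasEdge h red (pos x) (pos y)
      sorted fzero           fzero           z x<y _   _ = ⊥-elim (ℕ.<-irrefl refl x<y)
      sorted fzero           (fsuc fzero)    z _   y<z _ = ⊥-elim (ℕ.<⇒≱ y<z (pos≤R z))
      sorted fzero           (fsuc (fsuc b)) z _   _   _ = edges fzero (fsuc b) (s≤s z≤n) refl
      sorted (fsuc x)        fzero           z x<y _   _ = ⊥-elim (ℕ.<⇒≱ x<y (centre-least (fsuc x)))
      sorted (fsuc x)        (fsuc y)        fzero _ y<z _ = ⊥-elim (ℕ.<⇒≱ y<z (centre-least (fsuc y)))
      sorted (fsuc x)        (fsuc y)        (fsuc z) _ _ ()

    K3-from-blueClique : ∀ {n} → HasOrderedCopy h blue (Kcomplete (suc (suc n))) →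
      Contains (K3 (suc (suc (suc n)))) (complement G)
    K3-from-blueClique {n} copy@(f , mono , edges) =
      contains-from-positions (K3 (suc (suc (suc n)))) blue pos pos-injective pos≤R sorted
      where
      f<R = copy-revealed (λ _ → refl) copy
      pos : Fin (suc (suc (suc n))) → ℕ
      pos fzero    = R
      pos (fsuc a) = f a
      pos≤R : ∀ u → pos u ≤ R
      pos≤R fzero    = ℕ.≤-refl
      pos≤R (fsuc a) = ℕ.<⇒≤ (f<R a)
      pos-injective : Injective _≡_ _≡_ pos
      pos-injective {fzero}  {fzero}  _ = refl
      pos-injective {fzero}  {fsuc b} e = ⊥-elim (ℕ.<-irrefl (sym e) (f<R b))
      pos-injective {fsuc a} {fzero}  e = ⊥-elim (ℕ.<-irrefl e (f<R a))
      pos-injective {fsuc a} {fsuc b} e = cong fsuc (strictlyMonotone⇒injective mono e)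
      sorted : ∀ x y z → pos x < pos y → pos y < pos z → edge (K3 (suc (suc (suc n)))) x y z ≡ true →
        HasEdge h blue (pos x) (pos y)
      sorted fzero    y        z x<y _   _ = ⊥-elim (ℕ.<⇒≱ x<y (pos≤R y))
      sorted (fsuc a) fzero    z _   y<z _ = ⊥-elim (ℕ.<⇒≱ y<z (pos≤R z))
      sorted (fsuc a) (fsuc b) z a<b _   _ = edges a b (strictlyMonotone-reflects-< mono a b a<b) refl

open import Data.Nat using (ℕ; _≤_; _∸_; suc)
open import Data.Rational using (ℚ; 0ℚ; 1ℚ; ½; _<_; _*_; _-_) renaming (_≤_ to _≤ℚ_)

nonempty-if-count-exceeds : ∀ {A : Set} (xs : List A) t {q} → ℕtoℚ t < q → q ≤ℚ ℕtoℚ (length xs ℕ.+ t) →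
  ∃ (_∈ xs)
nonempty-if-count-exceeds []       t t<q q≤t = ⊥-elim (<⇒≱ t<q q≤t)
nonempty-if-count-exceeds (x ∷ xs) t _   _   = x , here refl

½≤1-α : ∀ {α} → α ≤ℚ ½ → ½ ≤ℚ 1ℚ - α
½≤1-α α≤½ = ℚ.+-monoʳ-≤ 1ℚ (ℚ.neg-antimono-≤ α≤½)

module _ {α : ℚ} (0<α : 0ℚ < α) (α≤½ : α ≤ℚ ½) where

  private
    β : ℚ
    β = 1ℚ - α
    α≥0 : 0ℚ ≤ℚ α
    α≥0 = ℚ.<⇒≤ 0<α
    α≤β : α ≤ℚ β
    α≤β = ℚ.≤-trans α≤½ (½≤1-α α≤½)
    β≤1 : β ≤ℚ 1ℚ
    β≤1 = ℚ.≤-trans (ℚ.+-monoʳ-≤ 1ℚ (ℚ.neg-antimono-≤ α≥0)) (ℚ.≤-reflexive (ℚ.+-identityʳ 1ℚ))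

  module _ {N : ℕ} (G : 3Graph (Fin (suc N))) where

    open ReservoirPainter G α

    reservoir-survives : ∀ B L {v r m} → let h = play B painter L in
      h ≢ [] → vertexCount h ≤ v → redCount h ≤ r → edgeCount h ≤ m →
      ℕtoℚ (suc v) * β ^ℚ r < ℕtoℚ (suc (suc N)) * (α ^ℚ r * β ^ℚ m) →
      ∃ (_∈ reservoir (simulate h))
    reservoir-survives B L {v} {r} {m} h≢[] count≤v red≤r edges≤m budget =
      nonempty-if-count-exceeds (reservoir σ) (revealed σ) {weight α h * ℕtoℚ (suc N)}
        (ℚ.≤-<-trans (ℕtoℚ-mono-≤ revealed≤v) surplus) (weighted-size (sound inv))
      where
      h : History
      h = play B painter L
      σ : State
      σ = simulate h
      inv : Invariant σ h
      inv = play-invariant α≥0 α≤β β≤1 B L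
      revealed≤v : revealed σ ≤ v
      revealed≤v = subst (_≤ v) (trans (vertexCount≡revealedAfter h h≢[]) (sym (revealed≡ inv))) count≤v
      surplus : ℕtoℚ v < weight α h * ℕtoℚ (suc N)
      surplus = surplus-after-weighting {w = weight α h} {β ^ℚ r} {α ^ℚ r * β ^ℚ m} v (suc N)
        (^ℚ-nonNeg r (ℚ.≤-trans α≥0 α≤β)) (weight-≤1 α≥0 α≤β β≤1 h)
        (weight-≥ α≥0 α≤β β≤1 h red≤r edges≤m) budget

    ramsey-from-play : ∀ {s n} B L → let h = play B painter L in
      HasOrderedCopy h red (ForwardStar (suc (suc s))) ⊎ HasOrderedCopy h blue (Kcomplete (suc (suc n))) →
      ∃ (_∈ reservoir (simulate h)) →
      Contains (LK (suc (suc s))) G ⊎ Contains (K3 (suc (suc (suc n)))) (complement G)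
    ramsey-from-play B L copy (w , w∈S) = [ inj₁ ∘ LK-from-redStar , inj₂ ∘ K3-from-blueClique ]′ copy
      where open Extraction (faithful (sound (play-invariant α≥0 α≤β β≤1 B L)) (w , w∈S)) w∈S

  ramsey-from-strategy : ∀ {s n B v r m} →
    BuilderWinsWithin (ForwardStar (suc (suc s))) (Kcomplete (suc (suc n))) B v r m → ∀ N →
    ℕtoℚ (suc v) * β ^ℚ r < ℕtoℚ (suc N) * (α ^ℚ r * β ^ℚ m) →
    RamseyProp (LK (suc (suc s))) (K3 (suc (suc (suc n)))) N
  ramsey-from-strategy {v = v} {r} {m} _ ℕ.zero budget _ = ⊥-elim (ℕ.n≮0 (ℕtoℚ-cancel-< v 0 v<0))
    where
    v<0 : ℕtoℚ v < ℕtoℚ 0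
    v<0 = subst (ℕtoℚ v <_) (ℚ.*-identityˡ (ℕtoℚ 0))
      (surplus-after-weighting {w = 1ℚ} {β ^ℚ r} {α ^ℚ r * β ^ℚ m} v 0
        (^ℚ-nonNeg r (ℚ.≤-trans α≥0 α≤β)) ℚ.≤-refl (weight-≥ α≥0 α≤β β≤1 [] {r} {m} ℕ.z≤n ℕ.z≤n) budget)
  ramsey-from-strategy {B = B} wins (suc N) budget G =
    let (L , copy , count≤v , red≤r , edges≤m) = wins (ReservoirPainter.painter G α)
    in ramsey-from-play G B L copy
         (reservoir-survives G B L ([ copy-played refl , copy-played refl ]′ copy) count≤v red≤r edges≤m budget)

lemma5p1 : (s n v r m : ℕ) → 3 ≤ s → 3 ≤ n →
    (∃[ B ] BuilderWinsWithin (ForwardStar s) (Kcomplete (n ∸ 1)) B v r m) →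
    (α : ℚ) → 0ℚ < α → α ≤ℚ ½ →
    ∃[ N ] RamseyProp (LK s) (K3 n) N ×
      (ℕtoℚ N * (α ^ℚ r) * ((1ℚ - α) ^ℚ m) ≤ℚ ℕtoℚ (suc v) * ((1ℚ - α) ^ℚ r))
lemma5p1 _ _ v r m (ℕ.s≤s (ℕ.s≤s (ℕ.s≤s _))) (ℕ.s≤s (ℕ.s≤s (ℕ.s≤s _))) (B , wins) α 0<α α≤½ =
  N , ramsey-from-strategy 0<α α≤½ wins N d<[N+1]c ,
  subst (_≤ℚ d) (sym (ℚ.*-assoc (ℕtoℚ N) (α ^ℚ r) (β ^ℚ m))) Nc≤d
  where
  β c d : ℚ
  β = 1ℚ - α
  c = α ^ℚ r * β ^ℚ m
  d = ℕtoℚ (suc v) * β ^ℚ r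
  0<β : 0ℚ < β
  0<β = ℚ.<-≤-trans (ℚ.positive⁻¹ ½) (½≤1-α α≤½)
  0<c : 0ℚ < c
  0<c = ℚ.positive⁻¹ c
    {{ℚ.pos*pos⇒pos (α ^ℚ r) {{ℚ.positive (^ℚ-pos r 0<α)}} (β ^ℚ m) {{ℚ.positive (^ℚ-pos m 0<β)}}}}
  0≤d : 0ℚ ≤ℚ d
  0≤d = nonNeg*nonNeg (ℕtoℚ-nonNeg (suc v)) (^ℚ-nonNeg r (ℚ.<⇒≤ 0<β))
  N : ℕ
  N = proj₁ (floor-multiple 0<c 0≤d)
  Nc≤d : ℕtoℚ N * c ≤ℚ d
  Nc≤d = proj₁ (proj₂ (floor-multiple 0<c 0≤d))
  d<[N+1]c : d < ℕtoℚ (suc N) * c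
  d<[N+1]c = proj₂ (proj₂ (floor-multiple 0<c 0≤d))
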